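{- Let $L$ be a locale, $S$ a subset of $L$, $f:L\to M$ a continuous map with $M$ compact and regular, and $B_M$ a basis of $M$ that is a sub-pcd-lattice of $M$. Let $S_f=S\cup\{f^-(b):b\in B_M\}$ and let $\lhd_f$ be the least relation on $S_f^*$ containing $\{(f^-(b),f^-(a)):a,b\in B_M,\ b\prec a\}$ and closed under conditions (1)–(5) below. If $f^-[\cdot]:M\to L$ preserves pseudocomplements, then for all $x,y\in S_f^*$: $x\lhd_f y$ if and only if there are $a,b\in B_M$ with $b\prec a$, $x\le f^-(b)$ and $f^-(a)\le y$.
   Context: Framework: constructive set theory CZF + RRS-$\bigcup$REA (intuitionistic logic, no Powerset, Restricted Separation only). A locale $(L,B)$ is a class-frame with a set basis $B$ such that every $x$ is the join of the set $\{b\in B:b\le x\}$. $y^*=\bigvee\{c\in B:c\wedge y=0\}$; $y\prec x$ iff $1=x\vee y^*$. Regular: $a=\bigvee\{b\in B:b\prec a\}$ for $a\in B$; compact: every subset of $B$ with join $1$ has a finite subset with join $1$. A continuous map $f:L\to M$ is a function $f^-:B_M\to L$ preserving the top, binary meets in the form $f^-(a)\wedge f^-(b)=\bigvee\{f^-(c):c\in B_M,c\le a,c\le b\}$, and covers; $f^-[a]=\bigvee\{f^-(b):b\in B_M,b\le a\}$. For $S\subseteq L$, $S^*$ is the least subset containing $S$ closed under $^*$ and finite meets and joins in $L$; a sub-pcd-lattice is a set closed under these operations. Conditions: (1) $0\lhd0$, $1\lhd1$; (2) $x\le a\lhd b\le y\Rightarrow x\lhd y$; (3) $x\lhd a,x\lhd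 b\Rightarrow x\lhd a\wedge b$; (4) $x\lhd a,y\lhd a\Rightarrow x\vee y\lhd a$; (5) $a\lhd b\Rightarrow b^*\lhd a^*$. -}

module Defs where

open import Level using (Level; _⊔_) renaming (suc to lsuc; zero to lzero)
open import Data.Bool using (Bool; true; false)
open import Data.Empty using (⊥)
open import Data.Nat using (ℕ)
open import Data.Fin using (Fin)
open import Data.Product using (Σ; _×_; _,_; proj₁)

-- A locale (L , B): a class-frame whose carrier lives in Set₁ (a "class"),
-- with joins of set-indexed families (index types in Set), and a set basis B.
record Locale : Set₂ where
  infix 4 _≤_
  infixr 7 _∧_
  field
    Carrier : Set₁
    _≤_     : Carrier → Carrier → Set
    ≤-refl  : ∀ {x} → x ≤ x
    ≤-trans : ∀ {x y z} → x ≤ y → y ≤ z → x ≤ z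
    -- (partial order: equality of elements is  x ≤ y × y ≤ x , see _≈_ below)
    ⋁       : (I : Set) → (I → Carrier) → Carrier
    ⋁-ub    : ∀ {I} (g : I → Carrier) (i : I) → g i ≤ ⋁ I g
    ⋁-least : ∀ {I} (g : I → Carrier) {x} → (∀ i → g i ≤ x) → ⋁ I g ≤ x
    _∧_     : Carrier → Carrier → Carrier
    ∧-lb₁   : ∀ {x y} → x ∧ y ≤ x
    ∧-lb₂   : ∀ {x y} → x ∧ y ≤ y
    ∧-glb   : ∀ {x y z} → z ≤ x → z ≤ y → z ≤ x ∧ y
    top     : Carrier
    ≤-top   : ∀ {x} → x ≤ top
    distrib : ∀ {I} (x : Carrier) (g : I → Carrier) →
              x ∧ ⋁ I g ≤ ⋁ I (λ i → x ∧ g i)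
    B       : Set
    β       : B → Carrier
    basis   : ∀ x → x ≤ ⋁ (Σ B (λ b → β b ≤ x)) (λ p → β (proj₁ p))

  infix 4 _≈_
  _≈_ : Carrier → Carrier → Set
  x ≈ y = (x ≤ y) × (y ≤ x)

  bot : Carrier
  bot = ⋁ ⊥ (λ ())

  infixr 6 _∨_
  _∨_ : Carrier → Carrier → Carrier
  x ∨ y = ⋁ Bool (λ { true → x ; false → y })

  _* : Carrier → Carrier
  y * = ⋁ (Σ B (λ c → β c ∧ y ≈ bot)) (λ p → β (proj₁ p))

  infix 4 _≺_
  _≺_ : Carrier → Carrier → Set
  y ≺ x = top ≈ x ∨ (y *)

open Locale public

Regular : Locale → Set
Regular M = ∀ (a : B M) →
  _≈_ M (β M a) (⋁ M (Σ (B M) (λ b → _≺_ M (β M b) (β M a))) (λ p → β M (proj₁ p)))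

Compact : Locale → Set₁
Compact M = ∀ (U : B M → Set) →
  _≈_ M (top M) (⋁ M (Σ (B M) U) (λ p → β M (proj₁ p))) →
  Σ ℕ (λ n → Σ (Fin n → Σ (B M) U) (λ h →
    _≈_ M (top M) (⋁ M (Fin n) (λ k → β M (proj₁ (h k))))))

SubPcdLattice : Locale → Set
SubPcdLattice M =
    Σ (B M) (λ c → _≈_ M (β M c) (top M))
  × Σ (B M) (λ c → _≈_ M (β M c) (bot M))
  × (∀ a b → Σ (B M) (λ c → _≈_ M (β M c) (_∧_ M (β M a) (β M b))))
  × (∀ a b → Σ (B M) (λ c → _≈_ M (β M c) (_∨_ M (β M a) (β M b))))
  × (∀ a → Σ (B M) (λ c → _≈_ M (β M c) (_* M (β M a))))

-- Continuous map f : L → M, given by f⁻ : B_M → L.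
record ContMap (L M : Locale) : Set₁ where
  field
    f⁻ : B M → Carrier L

  f⁻[_] : Carrier M → Carrier L
  f⁻[ a ] = ⋁ L (Σ (B M) (λ b → _≤_ M (β M b) a)) (λ p → f⁻ (proj₁ p))

  field
    pres-top  : _≈_ L (top L) f⁻[ top M ]
    pres-meet : ∀ a b → _≈_ L (_∧_ L (f⁻ a) (f⁻ b))
                  (⋁ L (Σ (B M) (λ c → _≤_ M (β M c) (β M a) × _≤_ M (β M c) (β M b)))
                       (λ p → f⁻ (proj₁ p)))
    pres-cov  : ∀ (a : B M) {I : Set} (U : I → B M) →
                _≤_ M (β M a) (⋁ M I (λ i → β M (U i))) →
                _≤_ L (f⁻ a) (⋁ L I (λ i → f⁻ (U i)))

open ContMap public

PreservesPcs : {L M : Locale} → ContMap L M → Set₁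
PreservesPcs {L} {M} f = ∀ (y : Carrier M) → _≈_ L (f⁻[_] f (_* M y)) (_* L (f⁻[_] f y))

module _ (L M : Locale) (I : Set) (s : I → Carrier L) (f : ContMap L M) where

  -- S_f^* where S = { s i : i ∈ I } and S_f = S ∪ { f⁻(b) : b ∈ B_M }:
  -- least subset of L containing S_f, closed under *, finite meets and joins
  -- (membership is extensional, i.e. respects equality ≈ in L).
  data Sf* : Carrier L → Set₁ where
    inS   : ∀ i → Sf* (s i)
    inF   : ∀ b → Sf* (f⁻ f b)
    top∈  : Sf* (top L)
    bot∈  : Sf* (bot L)
    ∧∈    : ∀ {x y} → Sf* x → Sf* y → Sf* (_∧_ L x y)
    ∨∈    : ∀ {x y} → Sf* x → Sf* y → Sf* (_∨_ L x y)
    *∈    : ∀ {x} → Sf* x → Sf* (_* L x)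
    resp  : ∀ {x y} → _≈_ L x y → Sf* x → Sf* y

  data _⊲f_ : Carrier L → Carrier L → Set₁ where
    gen : ∀ (a b : B M) → _≺_ M (β M b) (β M a) → f⁻ f b ⊲f f⁻ f a
    c1₀ : bot L ⊲f bot L
    c1₁ : top L ⊲f top L
    c2  : ∀ {x a b y} → Sf* x → Sf* y →
          _≤_ L x a → a ⊲f b → _≤_ L b y → x ⊲f y
    c3  : ∀ {x a b} → x ⊲f a → x ⊲f b → x ⊲f (_∧_ L a b)
    c4  : ∀ {x y a} → x ⊲f a → y ⊲f a → (_∨_ L x y) ⊲f a
    c5  : ∀ {a b} → a ⊲f b → (_* L b) ⊲f (_* L a)

{-# OPTIONS --safe #-}
module Submission where

-- The relation  x ⊲ y :⇔ x ≤ f⁻(b) and f⁻(a) ≤ y for some basic b ≺ a  contains the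
-- generators of ⊲_f and is closed under (1)–(5), so it contains ⊲_f; the converse is
-- one application of (2) to a generator. Closure under (3)–(5) rests on ≺ being stable
-- under ∧ and ∨ and reversed by *, on B_M being a sub-pcd-lattice (so the new witnesses
-- are basic), and on f⁻ commuting with * on basic elements.

open import Data.Bool using (true; false)
open import Data.Unit using (⊤; tt)
open import Data.Empty using (⊥)
open import Data.Product using (Σ; _×_; _,_; proj₁; proj₂)
open import Relation.Binary.Bundles using (Preorder)
open import Relation.Binary.PropositionalEquality using (_≡_; refl; isEquivalence)
open import Function.Bundles using (_⇔_; mk⇔)
-- Defs is opened fully only further down: it also exports the derived operations of a
-- locale (bot, _∨_, _*, _≺_, …) unapplied, and these would clash with  open Locale X.
open import Defs using (Locale; module Locale)

module LocaleProperties (X : Locale) where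

  open Locale X public

  ≤-preorder : Preorder _ _ _
  ≤-preorder = record
    { Carrier    = Carrier
    ; _≈_        = _≡_
    ; _≲_        = _≤_
    ; isPreorder = record
      { isEquivalence = isEquivalence
      ; reflexive     = λ { refl → ≤-refl }
      ; trans         = ≤-trans
      }
    }

  open import Relation.Binary.Reasoning.Preorder ≤-preorder

  bot-least : ∀ {x} → bot ≤ x
  bot-least = ⋁-least _ (λ ())

  x≤x∨y : ∀ {x y} → x ≤ x ∨ y
  x≤x∨y = ⋁-ub _ true

  y≤x∨y : ∀ {x y} → y ≤ x ∨ y
  y≤x∨y = ⋁-ub _ false

  ∨-least : ∀ {x y z} → x ≤ z → y ≤ z → x ∨ y ≤ z
  ∨-least p q = ⋁-least _ (λ { true → p ; false → q })

  ∧-mono : ∀ {x y x′ y′} → x ≤ x′ → y ≤ y′ → x ∧ y ≤ x′ ∧ y′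
  ∧-mono p q = ∧-glb (≤-trans ∧-lb₁ p) (≤-trans ∧-lb₂ q)

  ∨-mono : ∀ {x y x′ y′} → x ≤ x′ → y ≤ y′ → x ∨ y ≤ x′ ∨ y′
  ∨-mono p q = ∨-least (≤-trans p x≤x∨y) (≤-trans q y≤x∨y)

  ∧-comm : ∀ {x y} → x ∧ y ≤ y ∧ x
  ∧-comm = ∧-glb ∧-lb₂ ∧-lb₁

  ∧-distribˡ-∨ : ∀ {x y z} → x ∧ (y ∨ z) ≤ x ∧ y ∨ x ∧ z
  ∧-distribˡ-∨ {x} = ≤-trans (distrib x _) (⋁-least _ (λ { true → x≤x∨y ; false → y≤x∨y }))

  ∧-distribʳ-∨ : ∀ {x y z} → (x ∨ y) ∧ z ≤ x ∧ z ∨ y ∧ z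
  ∧-distribʳ-∨ = ≤-trans ∧-comm (≤-trans ∧-distribˡ-∨ (∨-mono ∧-comm ∧-comm))

  ∨-∧-∨-least : ∀ {x x′ y y′ z} →
                x ∧ y ≤ z → x ∧ y′ ≤ z → x′ ∧ y ≤ z → x′ ∧ y′ ≤ z →
                (x ∨ x′) ∧ (y ∨ y′) ≤ z
  ∨-∧-∨-least p p′ q q′ =
    ≤-trans ∧-distribʳ-∨
      (∨-least (≤-trans ∧-distribˡ-∨ (∨-least p p′))
               (≤-trans ∧-distribˡ-∨ (∨-least q q′)))

  x∧x*≤bot : ∀ {x} → x ∧ x * ≤ bot
  x∧x*≤bot {x} = ≤-trans (distrib x _) (⋁-least _ (λ { (c , c∧x≈bot) →
    ≤-trans ∧-comm (proj₁ c∧x≈bot) }))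

  ≤-*-intro : ∀ {y z} → z ∧ y ≤ bot → z ≤ y *
  ≤-*-intro {z = z} z∧y≤bot = ≤-trans (basis z) (⋁-least _ (λ { (c , c≤z) →
    ⋁-ub (λ p → β (proj₁ p)) (c , ≤-trans (∧-mono c≤z ≤-refl) z∧y≤bot , bot-least) }))

  *-antitone : ∀ {x y} → x ≤ y → y * ≤ x *
  *-antitone x≤y = ≤-*-intro (≤-trans (∧-mono ≤-refl x≤y) (≤-trans ∧-comm x∧x*≤bot))

  x≤x** : ∀ {x} → x ≤ x * *
  x≤x** = ≤-*-intro x∧x*≤bot

  *∧*≤∨* : ∀ {x y} → x * ∧ y * ≤ (x ∨ y) *
  *∧*≤∨* = ≤-*-intro (≤-trans ∧-distribˡ-∨
    (∨-least (≤-trans (∧-mono ∧-lb₁ ≤-refl) (≤-trans ∧-comm x∧x*≤bot))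
             (≤-trans (∧-mono ∧-lb₂ ≤-refl) (≤-trans ∧-comm x∧x*≤bot))))

  top≤bot* : top ≤ bot *
  top≤bot* = ≤-*-intro ∧-lb₂

  ≺-intro : ∀ {x y} → top ≤ x ∨ y * → y ≺ x
  ≺-intro top≤ = top≤ , ≤-top

  ≺-mono : ∀ {x x′ y y′} → y′ ≤ y → x ≤ x′ → y ≺ x → y′ ≺ x′
  ≺-mono y′≤y x≤x′ (top≤ , _) = ≺-intro (≤-trans top≤ (∨-mono x≤x′ (*-antitone y′≤y)))

  bot≺ : ∀ {x} → bot ≺ x
  bot≺ = ≺-intro (≤-trans top≤bot* y≤x∨y)

  ≺top : ∀ {y} → y ≺ top
  ≺top = ≺-intro x≤x∨y

  ≺-∧ : ∀ {x₁ x₂ y₁ y₂} → y₁ ≺ x₁ → y₂ ≺ x₂ → y₁ ∧ y₂ ≺ x₁ ∧ x₂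
  ≺-∧ {x₁} {x₂} {y₁} {y₂} (top≤₁ , _) (top≤₂ , _) = ≺-intro (begin
    top                                ≲⟨ ∧-glb top≤₁ top≤₂ ⟩
    (x₁ ∨ y₁ *) ∧ (x₂ ∨ y₂ *)          ≲⟨ ∨-∧-∨-least x≤x∨y (≤-trans ∧-lb₂ y₂*≤)
                                            (≤-trans ∧-lb₁ y₁*≤) (≤-trans ∧-lb₁ y₁*≤) ⟩
    x₁ ∧ x₂ ∨ (y₁ ∧ y₂) *              ∎)
    where
    y₁*≤ : y₁ * ≤ x₁ ∧ x₂ ∨ (y₁ ∧ y₂) *
    y₁*≤ = ≤-trans (*-antitone ∧-lb₁) y≤x∨y
    y₂*≤ : y₂ * ≤ x₁ ∧ x₂ ∨ (y₁ ∧ y₂) *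
    y₂*≤ = ≤-trans (*-antitone ∧-lb₂) y≤x∨y

  ≺-∨ : ∀ {x₁ x₂ y₁ y₂} → y₁ ≺ x₁ → y₂ ≺ x₂ → y₁ ∨ y₂ ≺ x₁ ∨ x₂
  ≺-∨ {x₁} {x₂} {y₁} {y₂} (top≤₁ , _) (top≤₂ , _) = ≺-intro (begin
    top                                ≲⟨ ∧-glb top≤₁ top≤₂ ⟩
    (x₁ ∨ y₁ *) ∧ (x₂ ∨ y₂ *)          ≲⟨ ∨-∧-∨-least (≤-trans ∧-lb₁ inner₁) (≤-trans ∧-lb₁ inner₁)
                                            (≤-trans ∧-lb₂ inner₂) (≤-trans *∧*≤∨* y≤x∨y) ⟩
    (x₁ ∨ x₂) ∨ (y₁ ∨ y₂) *            ∎)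
    where
    inner₁ : x₁ ≤ (x₁ ∨ x₂) ∨ (y₁ ∨ y₂) *
    inner₁ = ≤-trans x≤x∨y x≤x∨y
    inner₂ : x₂ ≤ (x₁ ∨ x₂) ∨ (y₁ ∨ y₂) *
    inner₂ = ≤-trans y≤x∨y x≤x∨y

  ≺-* : ∀ {x y} → y ≺ x → x * ≺ y *
  ≺-* {x} {y} (top≤ , _) = ≺-intro (begin
    top             ≲⟨ top≤ ⟩
    x ∨ y *         ≲⟨ ∨-least (≤-trans x≤x** y≤x∨y) x≤x∨y ⟩
    y * ∨ x * *     ∎)

open import Defs

module ContMapProperties {L M : Locale} (f : ContMap L M) where

  private
    module L = LocaleProperties L
    module M = LocaleProperties M

  f⁻-mono : ∀ {b c} → M.β b M.≤ M.β c → f⁻ f b L.≤ f⁻ f c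
  f⁻-mono {b} {c} b≤c =
    L.≤-trans (pres-cov f b {⊤} (λ _ → c) (M.≤-trans b≤c (M.⋁-ub _ tt))) (L.⋁-least _ (λ _ → L.≤-refl))

  f⁻-∧ : ∀ {b₁ b₂ c} → M.β b₁ M.∧ M.β b₂ M.≤ M.β c → f⁻ f b₁ L.∧ f⁻ f b₂ L.≤ f⁻ f c
  f⁻-∧ {b₁} {b₂} b₁∧b₂≤c = L.≤-trans (proj₁ (pres-meet f b₁ b₂))
    (L.⋁-least _ (λ { (d , d≤b₁ , d≤b₂) → f⁻-mono (M.≤-trans (M.∧-glb d≤b₁ d≤b₂) b₁∧b₂≤c) }))

  f⁻-∨ : ∀ {a₁ a₂ c} → M.β c M.≤ M.β a₁ M.∨ M.β a₂ → f⁻ f c L.≤ f⁻ f a₁ L.∨ f⁻ f a₂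
  f⁻-∨ {a₁} {a₂} {c} c≤a₁∨a₂ =
    L.≤-trans (pres-cov f c (λ { true → a₁ ; false → a₂ })
                (M.≤-trans c≤a₁∨a₂ (M.∨-least (M.⋁-ub _ true) (M.⋁-ub _ false))))
              (L.⋁-least _ (λ { true → L.x≤x∨y ; false → L.y≤x∨y }))

  f⁻-bot : ∀ {c} → M.β c M.≤ M.bot → f⁻ f c L.≤ L.bot
  f⁻-bot {c} c≤bot = L.≤-trans (pres-cov f c {⊥} (λ ()) (M.≤-trans c≤bot (M.⋁-least _ (λ ()))))
                               (L.⋁-least _ (λ ()))

  f⁻-top : ∀ {c} → M.top M.≤ M.β c → L.top L.≤ f⁻ f c
  f⁻-top top≤c = L.≤-trans (proj₁ (pres-top f))
    (L.⋁-least _ (λ { (d , d≤top) → f⁻-mono (M.≤-trans d≤top top≤c) }))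

  f⁻≤f⁻[β] : ∀ {b} → f⁻ f b L.≤ f⁻[_] f (M.β b)
  f⁻≤f⁻[β] {b} = L.⋁-ub (λ p → f⁻ f (proj₁ p)) (b , M.≤-refl)

  f⁻[β]≤f⁻ : ∀ {b} → f⁻[_] f (M.β b) L.≤ f⁻ f b
  f⁻[β]≤f⁻ = L.⋁-least _ (λ { (c , c≤b) → f⁻-mono c≤b })

  f⁻[]-mono : ∀ {x y} → x M.≤ y → f⁻[_] f x L.≤ f⁻[_] f y
  f⁻[]-mono x≤y = L.⋁-least _ (λ { (c , c≤x) → L.⋁-ub (λ p → f⁻ f (proj₁ p)) (c , M.≤-trans c≤x x≤y) })

  f⁻-* : PreservesPcs f → ∀ {a c} → M.β c M.≈ M.β a M.* → f⁻ f c L.≈ f⁻ f a L.*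
  f⁻-* pcs {a} {c} (c≤a* , a*≤c) =
      (begin
        f⁻ f c                   ≲⟨ f⁻≤f⁻[β] ⟩
        f⁻[_] f (M.β c)          ≲⟨ f⁻[]-mono c≤a* ⟩
        f⁻[_] f (M.β a M.*)      ≲⟨ proj₁ (pcs (M.β a)) ⟩
        f⁻[_] f (M.β a) L.*      ≲⟨ L.*-antitone f⁻≤f⁻[β] ⟩
        f⁻ f a L.*               ∎)
    , (begin
        f⁻ f a L.*               ≲⟨ L.*-antitone f⁻[β]≤f⁻ ⟩
        f⁻[_] f (M.β a) L.*      ≲⟨ proj₂ (pcs (M.β a)) ⟩
        f⁻[_] f (M.β a M.*)      ≲⟨ f⁻[]-mono a*≤c ⟩
        f⁻[_] f (M.β c)          ≲⟨ f⁻[β]≤f⁻ ⟩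
        f⁻ f c                   ∎)
    where open import Relation.Binary.Reasoning.Preorder L.≤-preorder

module WellInsideInterpolation {L M : Locale} (f : ContMap L M)
  (basisPcd : SubPcdLattice M) (pcs : PreservesPcs f) where

  private
    module L = LocaleProperties L
    module M = LocaleProperties M

  open ContMapProperties f

  topᴮ : B M
  topᴮ = proj₁ (proj₁ basisPcd)

  β-topᴮ : M.β topᴮ M.≈ M.top
  β-topᴮ = proj₂ (proj₁ basisPcd)

  botᴮ : B M
  botᴮ = proj₁ (proj₁ (proj₂ basisPcd))

  β-botᴮ : M.β botᴮ M.≈ M.bot
  β-botᴮ = proj₂ (proj₁ (proj₂ basisPcd))

  _∧ᴮ_ : B M → B M → B M
  a ∧ᴮ b = proj₁ (proj₁ (proj₂ (proj₂ basisPcd)) a b)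

  β-∧ᴮ : ∀ a b → M.β (a ∧ᴮ b) M.≈ M.β a M.∧ M.β b
  β-∧ᴮ a b = proj₂ (proj₁ (proj₂ (proj₂ basisPcd)) a b)

  _∨ᴮ_ : B M → B M → B M
  a ∨ᴮ b = proj₁ (proj₁ (proj₂ (proj₂ (proj₂ basisPcd))) a b)

  β-∨ᴮ : ∀ a b → M.β (a ∨ᴮ b) M.≈ M.β a M.∨ M.β b
  β-∨ᴮ a b = proj₂ (proj₁ (proj₂ (proj₂ (proj₂ basisPcd))) a b)

  _*ᴮ : B M → B M
  a *ᴮ = proj₁ (proj₂ (proj₂ (proj₂ (proj₂ basisPcd))) a)

  β-*ᴮ : ∀ a → M.β (a *ᴮ) M.≈ M.β a M.*
  β-*ᴮ a = proj₂ (proj₂ (proj₂ (proj₂ (proj₂ basisPcd))) a)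

  Interpolated : L.Carrier → L.Carrier → Set
  Interpolated x y = Σ (B M) λ a → Σ (B M) λ b →
    M.β b M.≺ M.β a × x L.≤ f⁻ f b × f⁻ f a L.≤ y

  interpolated-bot : Interpolated L.bot L.bot
  interpolated-bot =
    botᴮ , botᴮ , M.≺-mono (proj₁ β-botᴮ) (proj₂ β-botᴮ) M.bot≺ , L.bot-least , f⁻-bot (proj₁ β-botᴮ)

  interpolated-top : Interpolated L.top L.top
  interpolated-top =
    topᴮ , topᴮ , M.≺-mono M.≤-top (proj₂ β-topᴮ) M.≺top , f⁻-top (proj₂ β-topᴮ) , L.≤-top

  interpolated-widen : ∀ {x x′ y y′} → x′ L.≤ x → y L.≤ y′ → Interpolated x y → Interpolated x′ y′
  interpolated-widen x′≤x y≤y′ (a , b , b≺a , x≤b , a≤y) =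
    a , b , b≺a , L.≤-trans x′≤x x≤b , L.≤-trans a≤y y≤y′

  interpolated-∧ : ∀ {x y₁ y₂} → Interpolated x y₁ → Interpolated x y₂ → Interpolated x (y₁ L.∧ y₂)
  interpolated-∧ (a₁ , b₁ , b₁≺a₁ , x≤b₁ , a₁≤y₁) (a₂ , b₂ , b₂≺a₂ , x≤b₂ , a₂≤y₂) =
      a₁ ∧ᴮ a₂ , b₁ ∧ᴮ b₂
    , M.≺-mono (proj₁ (β-∧ᴮ b₁ b₂)) (proj₂ (β-∧ᴮ a₁ a₂)) (M.≺-∧ b₁≺a₁ b₂≺a₂)
    , L.≤-trans (L.∧-glb x≤b₁ x≤b₂) (f⁻-∧ (proj₂ (β-∧ᴮ b₁ b₂)))
    , L.∧-glb (L.≤-trans (f⁻-mono (M.≤-trans (proj₁ (β-∧ᴮ a₁ a₂)) M.∧-lb₁)) a₁≤y₁)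
              (L.≤-trans (f⁻-mono (M.≤-trans (proj₁ (β-∧ᴮ a₁ a₂)) M.∧-lb₂)) a₂≤y₂)

  interpolated-∨ : ∀ {x₁ x₂ y} → Interpolated x₁ y → Interpolated x₂ y → Interpolated (x₁ L.∨ x₂) y
  interpolated-∨ (a₁ , b₁ , b₁≺a₁ , x₁≤b₁ , a₁≤y) (a₂ , b₂ , b₂≺a₂ , x₂≤b₂ , a₂≤y) =
      a₁ ∨ᴮ a₂ , b₁ ∨ᴮ b₂
    , M.≺-mono (proj₁ (β-∨ᴮ b₁ b₂)) (proj₂ (β-∨ᴮ a₁ a₂)) (M.≺-∨ b₁≺a₁ b₂≺a₂)
    , L.∨-least (L.≤-trans x₁≤b₁ (f⁻-mono (M.≤-trans M.x≤x∨y (proj₂ (β-∨ᴮ b₁ b₂)))))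
                (L.≤-trans x₂≤b₂ (f⁻-mono (M.≤-trans M.y≤x∨y (proj₂ (β-∨ᴮ b₁ b₂)))))
    , L.≤-trans (f⁻-∨ (proj₁ (β-∨ᴮ a₁ a₂))) (L.∨-least a₁≤y a₂≤y)

  interpolated-* : ∀ {x y} → Interpolated x y → Interpolated (y L.*) (x L.*)
  interpolated-* (a , b , b≺a , x≤b , a≤y) =
      b *ᴮ , a *ᴮ
    , M.≺-mono (proj₁ (β-*ᴮ a)) (proj₂ (β-*ᴮ b)) (M.≺-* b≺a)
    , L.≤-trans (L.*-antitone a≤y) (proj₂ (f⁻-* pcs (β-*ᴮ a)))
    , L.≤-trans (proj₁ (f⁻-* pcs (β-*ᴮ b))) (L.*-antitone x≤b)

  ⊲f⇒interpolated : ∀ {I s x y} → _⊲f_ L M I s f x y → Interpolated x y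
  ⊲f⇒interpolated (gen a b b≺a)        = a , b , b≺a , L.≤-refl , L.≤-refl
  ⊲f⇒interpolated c1₀                  = interpolated-bot
  ⊲f⇒interpolated c1₁                  = interpolated-top
  ⊲f⇒interpolated (c2 _ _ x≤a a⊲b b≤y) = interpolated-widen x≤a b≤y (⊲f⇒interpolated a⊲b)
  ⊲f⇒interpolated (c3 x⊲a x⊲b)         = interpolated-∧ (⊲f⇒interpolated x⊲a) (⊲f⇒interpolated x⊲b)
  ⊲f⇒interpolated (c4 x⊲a y⊲a)         = interpolated-∨ (⊲f⇒interpolated x⊲a) (⊲f⇒interpolated y⊲a)
  ⊲f⇒interpolated (c5 a⊲b)             = interpolated-* (⊲f⇒interpolated a⊲b)

lemma4p7 : (L M : Locale) (I : Set) (s : I → Carrier L) (f : ContMap L M) →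
           Compact M → Regular M → SubPcdLattice M → PreservesPcs f →
           ∀ (x y : Carrier L) → Sf* L M I s f x → Sf* L M I s f y →
           (_⊲f_ L M I s f x y ⇔
             Σ (B M) (λ a → Σ (B M) (λ b →
               _≺_ M (β M b) (β M a) × _≤_ L x (f⁻ f b) × _≤_ L (f⁻ f a) y)))
lemma4p7 L M I s f _ _ basisPcd pcs x y x∈Sf* y∈Sf* =
  mk⇔ ⊲f⇒interpolated
      (λ (a , b , b≺a , x≤b , a≤y) → c2 x∈Sf* y∈Sf* x≤b (gen a b b≺a) a≤y)
  where open WellInsideInterpolation f basisPcd pcs
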